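{- Let $\ell$ and $n$ be positive integers with $\ell>1$, and let $b_{\ell}(n)$ be the number of $\ell$-regular partitions of $n$. If $\ell$ is even, then $b_{\ell}(n)\equiv d_{\ell}(n)\pmod 2$, where $d_{\ell}(n)$ is the number of partitions of $n$ into distinct parts each congruent to one of $0,1,3,\dots,\ell-3,\ell-1$ modulo $\ell$. If $\ell$ is odd, then $b_{\ell}(n)\equiv c_{\ell}(n)\pmod 2$, where $c_{\ell}(n)$ is the number of partitions of $n$ into distinct odd parts none of which is divisible by $\ell$.
   Context: A partition of a positive integer $n$ is a finite nonincreasing sequence of positive integers summing to $n$; its entries are its parts. For an integer $\ell>1$, a partition is called $\ell$-regular if none of its parts is divisible by $\ell$. -}

module Defs where

open import Data.Nat using (ℕ; zero; suc; _+_; _<_; _>_; _≥_; _%_; _≟_; _<?_; _≥?_)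
open import Data.Nat.Divisibility using (_∣_; _∣?_)
open import Data.Nat.ListAction using (sum)
open import Data.List using (List; []; _∷_; map; concatMap; filter; length)
open import Data.List.Relation.Unary.All using (All; all?)
open import Data.List.Relation.Unary.Linked using (Linked; linked?)
open import Data.Product using (_×_)
open import Data.Sum using (_⊎_)
open import Data.Empty using (⊥)
open import Relation.Nullary using (¬_; Dec; no)
open import Relation.Nullary.Decidable using (_×-dec_; _⊎-dec_; ¬?)
open import Relation.Unary using (Pred; Decidable)
open import Relation.Binary.PropositionalEquality using (_≡_)

IsPartition : ℕ → List ℕ → Set
IsPartition n λs = Linked _≥_ λs × All (λ p → 0 < p) λs × sum λs ≡ n

isPartition? : (n : ℕ) → Decidable (IsPartition n)
isPartition? n λs = linked? _≥?_ λs ×-dec all? (λ p → 0 <? p) λs ×-dec (sum λs ≟ n)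

oneTo : ℕ → List ℕ
oneTo zero = []
oneTo (suc n) = oneTo n Data.List.++ (suc n ∷ [])

listsUpTo : ℕ → ℕ → List (List ℕ)
listsUpTo zero m = [] ∷ []
listsUpTo (suc k) m = [] ∷ concatMap (λ x → map (x ∷_) (listsUpTo k m)) (oneTo m)

-- Every partition of n has at most n parts, each in {1,...,n}; so the
-- partitions of n satisfying P are counted by filtering this finite list.
countPartitions : (P : List ℕ → Set) → Decidable P → ℕ → ℕ
countPartitions P P? n =
  length (filter (λ λs → isPartition? n λs ×-dec P? λs) (listsUpTo n n))

Regular : ℕ → List ℕ → Set
Regular ℓ = All (λ p → ¬ (ℓ ∣ p))

regular? : (ℓ : ℕ) → Decidable (Regular ℓ)
regular? ℓ = all? (λ p → ¬? (ℓ ∣? p))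

b : ℕ → ℕ → ℕ
b ℓ = countPartitions (Regular ℓ) (regular? ℓ)

Distinct : List ℕ → Set
Distinct = Linked _>_

-- p is congruent mod ℓ to one of 0,1,3,...,ℓ-1, i.e. p mod ℓ is 0 or odd
-- (ℓ = 0 never occurs in the theorem since ℓ > 1)
DPart : ℕ → ℕ → Set
DPart zero p = ⊥
DPart (suc k) p = (p % suc k ≡ 0) ⊎ (p % suc k % 2 ≡ 1)

dPart? : (ℓ p : ℕ) → Dec (DPart ℓ p)
dPart? zero p = no (λ ())
dPart? (suc k) p = (p % suc k ≟ 0) ⊎-dec (p % suc k % 2 ≟ 1)

DProp : ℕ → List ℕ → Set
DProp ℓ λs = Distinct λs × All (DPart ℓ) λs

dProp? : (ℓ : ℕ) → Decidable (DProp ℓ)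
dProp? ℓ λs = linked? (λ x y → y <? x) λs ×-dec all? (dPart? ℓ) λs

d : ℕ → ℕ → ℕ
d ℓ = countPartitions (DProp ℓ) (dProp? ℓ)

CProp : ℕ → List ℕ → Set
CProp ℓ λs = Distinct λs × All (λ p → p % 2 ≡ 1 × ¬ (ℓ ∣ p)) λs

cProp? : (ℓ : ℕ) → Decidable (CProp ℓ)
cProp? ℓ λs = linked? (λ x y → y <? x) λs ×-dec all? (λ p → (p % 2 ≟ 1) ×-dec ¬? (ℓ ∣? p)) λs

c : ℕ → ℕ → ℕ
c ℓ = countPartitions (CProp ℓ) (cProp? ℓ)

-- Over 𝔽₂ the generating function of b_ℓ is ∏_{ℓ ∤ j} (1 + q^j)⁻¹, and those of
-- d_ℓ and c_ℓ are ∏_{j ∈ R} (1 + q^j) for the respective sets R of allowed parts: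
-- counting partitions by their largest part B reproduces multiplication by
-- (1 + q^B)^(∓1).  As (1 + q^x)² = 1 + q^(2x) mod 2, one factor (1 + q^j)⁻¹ equals
-- (1 + q^j)(1 + q^(2j))⁻¹ and two of them equal (1 + q^(2j))⁻¹.  Sweeping
-- j = 1, 2, … thus turns the inverse factors into factors (1 + q^j)^(r j) while
-- pushing an inverse factor with exponent p(2j) = q(j) ∨ p(j) on to index 2j; for ℓ
-- even, resp. odd, r is the indicator of the parts allowed in d_ℓ, resp. c_ℓ.
-- After n steps the pending factors all have index > n, so they do not affect the
-- coefficient of qⁿ.

module Submission where

open import Algebra.Properties.CommutativeSemigroup using (interchange)
open import Data.Bool.Base using (Bool; true; false; not; _∧_; _∨_; _xor_; if_then_else_)
open import Data.Bool.Properties using (∨-zeroʳ; ∨-identityʳ; ∨-abs-∧; ∧-comm; xor-annihilates-not; xor-identityʳ)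
open import Data.List.Base using (List; []; _∷_; _++_; map; concatMap; length; filter)
open import Data.List.Properties using (map-++)
open import Data.List.Relation.Unary.All as All using (All; []; _∷_)
open import Data.List.Relation.Unary.Linked as Linked using (Linked; []; [-]; _∷_)
open import Data.List.Relation.Unary.Linked.Properties using (Linked⇒All)
open import Data.Nat.Base
  using (ℕ; zero; suc; pred; _+_; _∸_; _%_; _≤_; _<_; _≡ᵇ_; z≤n; s≤s; NonZero; >-nonZero⁻¹; parity)
open import Data.Nat.Coprimality using (Coprime; coprime-divisor)
open import Data.Nat.Divisibility using (_∣_; _∣?_; m%n≡0⇒n∣m; n∣m⇒m%n≡0; m%n≡0⇔n∣m; ∣-trans; ∣m∣n⇒∣m+n)
open import Data.Nat.DivMod using (m∣n⇒o%n%m≡o%m)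
open import Data.Nat.Induction using (<-rec)
open import Data.Nat.ListAction using (sum)
open import Data.Nat.ListAction.Properties using (sum-++)
open import Data.Nat.Primality using (irreducible[2])
open import Data.Nat.Properties
  using (_≟_; _≤?_; +-assoc; +-comm; +-identityʳ; +-suc; <-≤-trans; <⇒≤; <⇒≤pred; <⇒≱; ≰⇒>; m+[n∸m]≡n; m+n∸m≡n;
         m<n+m; m∸n+n≡m; m∸n≤m; m≤m+n; m≤n+m; m≤n⇒m<n∨m≡n; m≤n⇒m≤1+n; n≤1+n; pred[n]≤n;
         ∸-monoʳ-≤; ∸-monoˡ-≤; ≤-pred; ≤-refl; ≤-trans)
open import Data.Parity.Base as ℙ using (Parity; 0ℙ; 1ℙ)
import Data.Parity.Properties as ℙ
open import Data.Product.Base using (_×_; _,_)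
open import Data.Sum.Base using (inj₁; inj₂)
open import Function.Bundles using (_⇔_; mk⇔)
open import Level using (0ℓ)
open import Relation.Binary.Bundles using (Setoid)
open import Relation.Binary.PropositionalEquality as ≡ using (_≡_)
open import Relation.Nullary using (¬_; Dec; yes; no; contradiction)
open import Relation.Nullary.Decidable using (does; dec-true; dec-false; does-⇔; ¬?; _×-dec_)
open import Relation.Unary using (Pred; Decidable)

open import Defs

-- Power series over 𝔽₂

-- Series and _≈_ are records without eta so that series expressions are not
-- unfolded to their coefficients during unification.
record Series : Set where
  no-eta-equality
  field coeff : ℕ → Parity

open Series

infix 4 _≈_ _≈[<_]_

record _≈_ (s t : Series) : Set where
  constructor coeffwise
  field at : ∀ n → coeff s n ≡ coeff t n

open _≈_

_≈[<_]_ : Series → ℕ → Series → Set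
s ≈[< n ] t = ∀ {m} → m < n → coeff s m ≡ coeff t m

≈-setoid : Setoid 0ℓ 0ℓ
≈-setoid = record
  { Carrier = Series
  ; _≈_ = _≈_
  ; isEquivalence = record
    { refl = coeffwise λ _ → ≡.refl
    ; sym = λ p → coeffwise λ n → ≡.sym (at p n)
    ; trans = λ p q → coeffwise λ n → ≡.trans (at p n) (at q n)
    }
  }

open Setoid ≈-setoid using () renaming (refl to ≈-refl; sym to ≈-sym; trans to ≈-trans)
import Relation.Binary.Reasoning.Setoid ≈-setoid as ≈-Reasoning

1ₛ : Series
coeff 1ₛ zero = 1ℙ
coeff 1ₛ (suc n) = 0ℙ

infixl 6 _⊕_

_⊕_ : Series → Series → Series
coeff (s ⊕ t) n = coeff s n ℙ.+ coeff t n

⊕-cong : ∀ {s s′ t t′} → s ≈ s′ → t ≈ t′ → s ⊕ t ≈ s′ ⊕ t′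
⊕-cong p q = coeffwise λ n → ≡.cong₂ ℙ._+_ (at p n) (at q n)

⊕-congˡ : ∀ {s t t′} → t ≈ t′ → s ⊕ t ≈ s ⊕ t′
⊕-congˡ = ⊕-cong ≈-refl

⊕-congʳ : ∀ {s s′ t} → s ≈ s′ → s ⊕ t ≈ s′ ⊕ t
⊕-congʳ p = ⊕-cong p ≈-refl

⊕-assoc : ∀ s t u → (s ⊕ t) ⊕ u ≈ s ⊕ (t ⊕ u)
⊕-assoc s t u = coeffwise λ n → ℙ.+-assoc (coeff s n) (coeff t n) (coeff u n)

⊕-comm : ∀ s t → s ⊕ t ≈ t ⊕ s
⊕-comm s t = coeffwise λ n → ℙ.+-comm (coeff s n) (coeff t n)

⊕-interchange : ∀ s t u v → (s ⊕ t) ⊕ (u ⊕ v) ≈ (s ⊕ u) ⊕ (t ⊕ v)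
⊕-interchange s t u v = coeffwise λ n →
  interchange ℙ.+-commutativeSemigroup (coeff s n) (coeff t n) (coeff u n) (coeff v n)

⊕-cancelˡ : ∀ s t → s ⊕ (s ⊕ t) ≈ t
⊕-cancelˡ s t = coeffwise λ n → ≡.trans (≡.sym (ℙ.+-assoc (coeff s n) (coeff s n) (coeff t n)))
  (≡.cong (ℙ._+ coeff t n) (ℙ.p+p≡0ℙ (coeff s n)))

infixr 7 q^_*_

q^_*_ : ℕ → Series → Series
coeff (q^ zero * s) n = coeff s n
coeff (q^ suc x * s) zero = 0ℙ
coeff (q^ suc x * s) (suc n) = coeff (q^ x * s) n

q^-agree : ∀ x {n s t} → s ≈[< n ] t → q^ x * s ≈[< x + n ] q^ x * t
q^-agree zero s≈t m<n = s≈t m<n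
q^-agree (suc x) s≈t {zero} _ = ≡.refl
q^-agree (suc x) s≈t {suc m} (s≤s m<x+n) = q^-agree x s≈t m<x+n

q^-cong : ∀ x {s t} → s ≈ t → q^ x * s ≈ q^ x * t
q^-cong zero s≈t = coeffwise (at s≈t)
q^-cong (suc x) s≈t = coeffwise λ where
  zero → ≡.refl
  (suc n) → at (q^-cong x s≈t) n

q^-⊕ : ∀ x s t → q^ x * (s ⊕ t) ≈ q^ x * s ⊕ q^ x * t
q^-⊕ zero s t = coeffwise λ _ → ≡.refl
q^-⊕ (suc x) s t = coeffwise λ where
  zero → ≡.refl
  (suc n) → at (q^-⊕ x s t) n

q^-q^ : ∀ x y s → q^ x * q^ y * s ≈ q^ (x + y) * s
q^-q^ zero y s = coeffwise λ _ → ≡.refl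
q^-q^ (suc x) y s = coeffwise λ where
  zero → ≡.refl
  (suc n) → at (q^-q^ x y s) n

q^-comm : ∀ x y s → q^ x * q^ y * s ≈ q^ y * q^ x * s
q^-comm x y s = begin
  q^ x * q^ y * s   ≈⟨ q^-q^ x y s ⟩
  q^ (x + y) * s    ≡⟨ ≡.cong (q^_* s) (+-comm x y) ⟩
  q^ (y + x) * s    ≈⟨ ≈-sym (q^-q^ y x s) ⟩
  q^ y * q^ x * s   ∎
  where open ≈-Reasoning

q^-below : ∀ {x n} s → n < x → coeff (q^ x * s) n ≡ 0ℙ
q^-below {suc x} {zero} s _ = ≡.refl
q^-below {suc x} {suc n} s (s≤s n<x) = q^-below s n<x

q^-≤ : ∀ {x n} s → x ≤ n → coeff (q^ x * s) n ≡ coeff s (n ∸ x)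
q^-≤ {zero} s _ = ≡.refl
q^-≤ {suc x} {suc n} s (s≤s x≤n) = q^-≤ s x≤n

geometric : ℕ → ℕ → Series → Series
geometric x zero s = s
geometric x (suc k) s = s ⊕ q^ x * geometric x k s

geometric-step : ∀ x .{{_ : NonZero x}} k s → geometric x (suc k) s ≈[< suc k ] geometric x k s
geometric-step (suc x) zero s {zero} _ = ℙ.+-identityʳ (coeff s 0)
geometric-step (suc x) zero s {suc m} (s≤s ())
geometric-step (suc x) (suc k) s {m} m<2+k = ≡.cong (coeff s m ℙ.+_)
  (q^-agree (suc x) (geometric-step (suc x) k s) (<-≤-trans m<2+k (m<n+m (suc k) (s≤s z≤n))))

geometric-stable : ∀ x .{{_ : NonZero x}} d k s → geometric x (d + k) s ≈[< suc k ] geometric x k s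
geometric-stable x zero k s _ = ≡.refl
geometric-stable x (suc d) k s m<1+k = ≡.trans
  (geometric-step x (d + k) s (<-≤-trans m<1+k (s≤s (m≤n+m k d))))
  (geometric-stable x d k s m<1+k)

infixl 8 _/[1+q^_]

-- For x ≥ 1 the n-th coefficient of s / (1 + q^x) is that of the truncated
-- geometric series s (1 + q^x + ⋯ + q^(n x)); for x = 0 the value is junk.
_/[1+q^_] : Series → ℕ → Series
coeff (s /[1+q^ x ]) n = coeff (geometric x n s) n

/-geometric : ∀ x .{{_ : NonZero x}} k s → s /[1+q^ x ] ≈[< suc k ] geometric x k s
/-geometric x k s {m} m<1+k = ≡.sym (≡.subst (λ j → coeff (geometric x j s) m ≡ coeff (geometric x m s) m)
  (m∸n+n≡m (≤-pred m<1+k)) (geometric-stable x (k ∸ m) m s ≤-refl))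

/-eq : ∀ x .{{_ : NonZero x}} s → s /[1+q^ x ] ≈ s ⊕ q^ x * s /[1+q^ x ]
/-eq (suc x) s = coeffwise λ where
  zero → ≡.sym (ℙ.+-identityʳ (coeff s 0))
  (suc n) → ≡.cong (coeff s (suc n) ℙ.+_) (q^-agree (suc x)
    (λ m<1+n → ≡.sym (/-geometric (suc x) n s m<1+n)) (m<n+m (suc n) (s≤s z≤n)))

/-unique : ∀ x .{{_ : NonZero x}} {s t} → t ≈ s ⊕ q^ x * t → t ≈ s /[1+q^ x ]
/-unique x {s} {t} t-eq = coeffwise (<-rec _ step)
  where
  step : ∀ n → (∀ {m} → m < n → coeff t m ≡ coeff (s /[1+q^ x ]) m) → coeff t n ≡ coeff (s /[1+q^ x ]) n
  step n t≈[<n] = ≡.trans (at t-eq n) (≡.trans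
    (≡.cong (coeff s n ℙ.+_) (q^-agree x t≈[<n] (m<n+m n (>-nonZero⁻¹ x))))
    (≡.sym (at (/-eq x s) n)))

/-below : ∀ x .{{_ : NonZero x}} s → s /[1+q^ x ] ≈[< x ] s
/-below x s {m} m<x = ≡.trans (at (/-eq x s) m)
  (≡.trans (≡.cong (coeff s m ℙ.+_) (q^-below (s /[1+q^ x ]) m<x)) (ℙ.+-identityʳ (coeff s m)))

infixr 7 [1+q^_]*_

[1+q^_]*_ : ℕ → Series → Series
[1+q^ x ]* s = s ⊕ q^ x * s

record IsMultiplier (F : Series → Series) : Set where
  field
    cong       : ∀ {s t} → s ≈ t → F s ≈ F t
    ⊕-homo     : ∀ s t → F (s ⊕ t) ≈ F s ⊕ F t
    q^-commute : ∀ x s → F (q^ x * s) ≈ q^ x * F s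

open IsMultiplier

id-isMultiplier : IsMultiplier (λ s → s)
id-isMultiplier = record { cong = λ p → p ; ⊕-homo = λ _ _ → ≈-refl ; q^-commute = λ _ _ → ≈-refl }

∘-isMultiplier : ∀ {F G} → IsMultiplier F → IsMultiplier G → IsMultiplier (λ s → F (G s))
∘-isMultiplier F-mul G-mul = record
  { cong = λ p → cong F-mul (cong G-mul p)
  ; ⊕-homo = λ s t → ≈-trans (cong F-mul (⊕-homo G-mul s t)) (⊕-homo F-mul _ _)
  ; q^-commute = λ x s → ≈-trans (cong F-mul (q^-commute G-mul x s)) (q^-commute F-mul x _)
  }

*-isMultiplier : ∀ x → IsMultiplier ([1+q^ x ]*_)
*-isMultiplier x = record
  { cong = λ s≈t → ⊕-cong s≈t (q^-cong x s≈t)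
  ; ⊕-homo = λ s t → ≈-trans (⊕-congˡ (q^-⊕ x s t)) (⊕-interchange s t (q^ x * s) (q^ x * t))
  ; q^-commute = λ y s → ≈-trans (⊕-congˡ (q^-comm x y s)) (≈-sym (q^-⊕ y s (q^ x * s)))
  }

/-isMultiplier : ∀ x .{{_ : NonZero x}} → IsMultiplier (_/[1+q^ x ])
/-isMultiplier x = record
  { cong = λ {s} s≈t → /-unique x (≈-trans (/-eq x s) (⊕-congʳ s≈t))
  ; ⊕-homo = λ s t → ≈-sym (/-unique x (begin
      s /[1+q^ x ] ⊕ t /[1+q^ x ]
        ≈⟨ ⊕-cong (/-eq x s) (/-eq x t) ⟩
      (s ⊕ q^ x * s /[1+q^ x ]) ⊕ (t ⊕ q^ x * t /[1+q^ x ])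
        ≈⟨ ⊕-interchange s _ t _ ⟩
      (s ⊕ t) ⊕ (q^ x * s /[1+q^ x ] ⊕ q^ x * t /[1+q^ x ])
        ≈⟨ ⊕-congˡ (≈-sym (q^-⊕ x _ _)) ⟩
      (s ⊕ t) ⊕ q^ x * (s /[1+q^ x ] ⊕ t /[1+q^ x ])
        ∎))
  ; q^-commute = λ y s → ≈-sym (/-unique x (begin
      q^ y * s /[1+q^ x ]                    ≈⟨ q^-cong y (/-eq x s) ⟩
      q^ y * (s ⊕ q^ x * s /[1+q^ x ])       ≈⟨ q^-⊕ y s _ ⟩
      q^ y * s ⊕ q^ y * q^ x * s /[1+q^ x ]  ≈⟨ ⊕-congˡ (q^-comm y x _) ⟩
      q^ y * s ⊕ q^ x * q^ y * s /[1+q^ x ]  ∎))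
  }
  where open ≈-Reasoning

*-commute : ∀ {F} → IsMultiplier F → ∀ x s → [1+q^ x ]* F s ≈ F ([1+q^ x ]* s)
*-commute F-mul x s = ≈-trans (⊕-congˡ (≈-sym (q^-commute F-mul x s))) (≈-sym (⊕-homo F-mul s (q^ x * s)))

/-commute : ∀ {F} → IsMultiplier F → ∀ x .{{_ : NonZero x}} s → F s /[1+q^ x ] ≈ F (s /[1+q^ x ])
/-commute {F} F-mul x s = ≈-sym (/-unique x (begin
  F (s /[1+q^ x ])                ≈⟨ cong F-mul (/-eq x s) ⟩
  F (s ⊕ q^ x * s /[1+q^ x ])     ≈⟨ ⊕-homo F-mul s _ ⟩
  F s ⊕ F (q^ x * s /[1+q^ x ])   ≈⟨ ⊕-congˡ (q^-commute F-mul x _) ⟩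
  F s ⊕ q^ x * F (s /[1+q^ x ])   ∎))
  where open ≈-Reasoning

/-/ : ∀ x .{{_ : NonZero x}} s → s /[1+q^ x ] /[1+q^ x ] ≈ s /[1+q^ x + x ]
/-/ x@(suc _) s = /-unique (x + x) (begin
  w                            ≈⟨ /-eq x u ⟩
  u ⊕ q^ x * w                 ≈⟨ ⊕-congʳ (/-eq x s) ⟩
  (s ⊕ q^ x * u) ⊕ q^ x * w    ≈⟨ ⊕-assoc s _ _ ⟩
  s ⊕ (q^ x * u ⊕ q^ x * w)    ≈⟨ ⊕-congˡ (≈-sym (q^-⊕ x u w)) ⟩
  s ⊕ q^ x * (u ⊕ w)           ≈⟨ ⊕-congˡ (q^-cong x u⊕w≈q^w) ⟩
  s ⊕ q^ x * q^ x * w          ≈⟨ ⊕-congˡ (q^-q^ x x w) ⟩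
  s ⊕ q^ (x + x) * w           ∎)
  where
  open ≈-Reasoning
  u = s /[1+q^ x ]
  w = u /[1+q^ x ]
  u⊕w≈q^w : u ⊕ w ≈ q^ x * w
  u⊕w≈q^w = ≈-trans (⊕-congˡ (/-eq x u)) (⊕-cancelˡ u (q^ x * w))

/≈*/ : ∀ x .{{_ : NonZero x}} s → s /[1+q^ x ] ≈ [1+q^ x ]* s /[1+q^ x + x ]
/≈*/ x@(suc _) s = ≈-sym (/-unique x (begin
  v ⊕ q^ x * v                          ≈⟨ ⊕-congʳ (/-eq (x + x) s) ⟩
  (s ⊕ q^ (x + x) * v) ⊕ q^ x * v       ≈⟨ ⊕-assoc s _ _ ⟩
  s ⊕ (q^ (x + x) * v ⊕ q^ x * v)       ≈⟨ ⊕-congˡ (⊕-comm _ _) ⟩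
  s ⊕ (q^ x * v ⊕ q^ (x + x) * v)       ≈⟨ ⊕-congˡ (⊕-congˡ (≈-sym (q^-q^ x x v))) ⟩
  s ⊕ (q^ x * v ⊕ q^ x * q^ x * v)      ≈⟨ ⊕-congˡ (≈-sym (q^-⊕ x v _)) ⟩
  s ⊕ q^ x * (v ⊕ q^ x * v)             ∎))
  where
  open ≈-Reasoning
  v = s /[1+q^ x + x ]

infixr 7 [1+q^_]^_*_
infixl 8 _/[1+q^_]^_

[1+q^_]^_*_ : ℕ → Bool → Series → Series
[1+q^ x ]^ true * s = [1+q^ x ]* s
[1+q^ x ]^ false * s = s

_/[1+q^_]^_ : Series → ℕ → Bool → Series
s /[1+q^ x ]^ true = s /[1+q^ x ]
s /[1+q^ x ]^ false = s

*^-isMultiplier : ∀ x b → IsMultiplier ([1+q^ x ]^ b *_)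
*^-isMultiplier x true = *-isMultiplier x
*^-isMultiplier x false = id-isMultiplier

/^-isMultiplier : ∀ x .{{_ : NonZero x}} b → IsMultiplier (_/[1+q^ x ]^ b)
/^-isMultiplier x true = /-isMultiplier x
/^-isMultiplier x false = id-isMultiplier

*^-commute : ∀ {F} → IsMultiplier F → ∀ x b s → [1+q^ x ]^ b * F s ≈ F ([1+q^ x ]^ b * s)
*^-commute F-mul x true s = *-commute F-mul x s
*^-commute F-mul x false s = ≈-refl

/^-commute : ∀ {F} → IsMultiplier F → ∀ x .{{_ : NonZero x}} b s → F s /[1+q^ x ]^ b ≈ F (s /[1+q^ x ]^ b)
/^-commute F-mul x true s = /-commute F-mul x s
/^-commute F-mul x false s = ≈-refl

-- Over 𝔽₂, (1 + q^x)² = 1 + q^(2x).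
/^-/^ : ∀ x .{{_ : NonZero x}} a b s →
  s /[1+q^ x ]^ b /[1+q^ x ]^ a ≈ [1+q^ x ]^ (a xor b) * s /[1+q^ x + x ]^ (a ∨ b)
/^-/^ x true true s = /-/ x s
/^-/^ x true false s = /≈*/ x s
/^-/^ x false true s = /≈*/ x s
/^-/^ x false false s = ≈-refl

/^-below : ∀ x .{{_ : NonZero x}} b s → s /[1+q^ x ]^ b ≈[< x ] s
/^-below x true s = /-below x s
/^-below x false s _ = ≡.refl

*^-agree : ∀ x b {n s t} → s ≈[< n ] t → [1+q^ x ]^ b * s ≈[< n ] [1+q^ x ]^ b * t
*^-agree x true {n} s≈t m<n = ≡.cong₂ ℙ._+_ (s≈t m<n) (q^-agree x s≈t (<-≤-trans m<n (m≤n+m n x)))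
*^-agree x false s≈t = s≈t

divUpTo : (ℕ → Bool) → ℕ → Series → Series
divUpTo e zero s = s
divUpTo e (suc N) s = divUpTo e N s /[1+q^ suc N ]^ e (suc N)

mulUpTo : (ℕ → Bool) → ℕ → Series → Series
mulUpTo e zero s = s
mulUpTo e (suc N) s = [1+q^ suc N ]^ e (suc N) * mulUpTo e N s

divRange : (ℕ → Bool) → ℕ → ℕ → Series → Series
divRange e a zero s = s
divRange e a (suc k) s = divRange e (suc a) k s /[1+q^ suc a ]^ e (suc a)

mulUpTo-isMultiplier : ∀ e N → IsMultiplier (mulUpTo e N)
mulUpTo-isMultiplier e zero = id-isMultiplier
mulUpTo-isMultiplier e (suc N) =
  ∘-isMultiplier (*^-isMultiplier (suc N) (e (suc N))) (mulUpTo-isMultiplier e N)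

divRange-isMultiplier : ∀ e a k → IsMultiplier (divRange e a k)
divRange-isMultiplier e a zero = id-isMultiplier
divRange-isMultiplier e a (suc k) =
  ∘-isMultiplier (/^-isMultiplier (suc a) (e (suc a))) (divRange-isMultiplier e (suc a) k)

divRange-snoc : ∀ e a k s → divRange e a (suc k) s ≡ divRange e a k (s /[1+q^ suc (a + k) ]^ e (suc (a + k)))
divRange-snoc e a zero s = ≡.cong (λ j → s /[1+q^ suc j ]^ e (suc j)) (≡.sym (+-identityʳ a))
divRange-snoc e a (suc k) s = ≡.trans
  (≡.cong (_/[1+q^ suc a ]^ e (suc a)) (divRange-snoc e (suc a) k s))
  (≡.cong (λ j → divRange e a (suc k) (s /[1+q^ suc j ]^ e (suc j))) (≡.sym (+-suc a k)))

divRange-below : ∀ e a k s → divRange e a k s ≈[< suc a ] s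
divRange-below e a zero s _ = ≡.refl
divRange-below e a (suc k) s m<1+a =
  ≡.trans (/^-below (suc a) (e (suc a)) _ m<1+a) (divRange-below e (suc a) k s (<-≤-trans m<1+a (n≤1+n _)))

mulUpTo-agree : ∀ e N {n s t} → s ≈[< n ] t → mulUpTo e N s ≈[< n ] mulUpTo e N t
mulUpTo-agree e zero s≈t = s≈t
mulUpTo-agree e (suc N) s≈t = *^-agree (suc N) (e (suc N)) (mulUpTo-agree e N s≈t)

-- p j is the exponent of (1 + q^j)^(-1) still pending after the factors of
-- index < j have been converted, via /^-/^, into factors (1 + q^j)^(r j).
record Carry (q r p : ℕ → Bool) : Set where
  field
    carry-double : ∀ m → p (suc m + suc m) ≡ q (suc m) ∨ p (suc m)
    carry-odd    : ∀ m → p (suc (m + m)) ≡ false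
    residue      : ∀ m → r (suc m) ≡ q (suc m) xor p (suc m)

module _ {q r p} (carry : Carry q r p) where
  open Carry carry

  pending-suc : ∀ N s → let M = suc N in
    divRange p M (suc M) s ≡ divRange p M N (s /[1+q^ M + M ]^ p (M + M))
  pending-suc N s = begin
    divRange p M (suc M) s
      ≡⟨ divRange-snoc p M (suc N) s ⟩
    divRange p M (suc N) (s /[1+q^ suc (M + M) ]^ p (suc (M + M)))
      ≡⟨ ≡.cong (λ b → divRange p M (suc N) (s /[1+q^ suc (M + M) ]^ b)) (carry-odd M) ⟩
    divRange p M (suc N) s
      ≡⟨ divRange-snoc p M N s ⟩
    divRange p M N (s /[1+q^ suc (M + N) ]^ p (suc (M + N)))
      ≡⟨ ≡.cong (λ j → divRange p M N (s /[1+q^ j ]^ p j)) (≡.cong suc (≡.sym (+-suc N N))) ⟩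
    divRange p M N (s /[1+q^ M + M ]^ p (M + M))
      ∎
    where
    open ≡.≡-Reasoning
    M = suc N

  -- The pending range N+1 … 2N+1 ends in a trivial factor (carry-odd N), but
  -- starting it at N+1 lets the step split off its first factor definitionally.
  divUpTo≈mulUpTo-pending : ∀ N s → divUpTo q N s ≈ mulUpTo r N (divRange p N (suc N) s)
  divUpTo≈mulUpTo-pending zero s rewrite carry-odd 0 = ≈-refl
  divUpTo≈mulUpTo-pending (suc N) s = begin
    divUpTo q N s /[1+q^ M ]^ q M
      ≈⟨ cong (/^-isMultiplier M (q M)) (divUpTo≈mulUpTo-pending N s) ⟩
    mulUpTo r N (T /[1+q^ M ]^ p M) /[1+q^ M ]^ q M
      ≈⟨ /^-commute (mulUpTo-isMultiplier r N) M (q M) _ ⟩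
    mulUpTo r N (T /[1+q^ M ]^ p M /[1+q^ M ]^ q M)
      ≈⟨ cong (mulUpTo-isMultiplier r N) (/^-/^ M (q M) (p M) T) ⟩
    mulUpTo r N ([1+q^ M ]^ (q M xor p M) * T /[1+q^ M + M ]^ (q M ∨ p M))
      ≈⟨ ≈-sym (*^-commute (mulUpTo-isMultiplier r N) M (q M xor p M) _) ⟩
    [1+q^ M ]^ (q M xor p M) * mulUpTo r N (T /[1+q^ M + M ]^ (q M ∨ p M))
      ≡⟨ ≡.cong₂ (λ b c → [1+q^ M ]^ b * mulUpTo r N (T /[1+q^ M + M ]^ c))
           (≡.sym (residue N)) (≡.sym (carry-double N)) ⟩
    [1+q^ M ]^ r M * mulUpTo r N (T /[1+q^ M + M ]^ p (M + M))
      ≈⟨ cong (mulUpTo-isMultiplier r (suc N))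
           (/^-commute (divRange-isMultiplier p M N) (M + M) (p (M + M)) s) ⟩
    [1+q^ M ]^ r M * mulUpTo r N (divRange p M N (s /[1+q^ M + M ]^ p (M + M)))
      ≡⟨ ≡.cong (λ t → [1+q^ M ]^ r M * mulUpTo r N t) (≡.sym (pending-suc N s)) ⟩
    [1+q^ M ]^ r M * mulUpTo r N (divRange p M (suc M) s)
      ∎
    where
    open ≈-Reasoning
    M = suc N
    T = divRange p M N s

  divUpTo-coeff≡mulUpTo-coeff : ∀ n → coeff (divUpTo q n 1ₛ) n ≡ coeff (mulUpTo r n 1ₛ) n
  divUpTo-coeff≡mulUpTo-coeff n = ≡.trans (at (divUpTo≈mulUpTo-pending n 1ₛ) n)
    (mulUpTo-agree r n (divRange-below p n (suc n) 1ₛ) ≤-refl)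

-- Counting partitions

[_] : Bool → ℕ
[ true ] = 1
[ false ] = 0

count : ∀ {A : Set} → (A → Bool) → List A → ℕ
count f [] = 0
count f (x ∷ xs) = [ f x ] + count f xs

count-++ : ∀ {A : Set} (f : A → Bool) xs ys → count f (xs ++ ys) ≡ count f xs + count f ys
count-++ f [] ys = ≡.refl
count-++ f (x ∷ xs) ys = ≡.trans (≡.cong ([ f x ] +_) (count-++ f xs ys)) (≡.sym (+-assoc [ f x ] _ _))

count-concatMap : ∀ {A B : Set} (f : B → Bool) (g : A → List B) xs →
  count f (concatMap g xs) ≡ sum (map (λ x → count f (g x)) xs)
count-concatMap f g [] = ≡.refl
count-concatMap f g (x ∷ xs) =
  ≡.trans (count-++ f (g x) (concatMap g xs)) (≡.cong (count f (g x) +_) (count-concatMap f g xs))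

count-map : ∀ {A B : Set} (f : B → Bool) (h : A → B) xs → count f (map h xs) ≡ count (λ x → f (h x)) xs
count-map f h [] = ≡.refl
count-map f h (x ∷ xs) = ≡.cong ([ f (h x) ] +_) (count-map f h xs)

count-∧ : ∀ {A : Set} c (f : A → Bool) xs → count (λ x → c ∧ f x) xs ≡ (if c then count f xs else 0)
count-∧ true f xs = ≡.refl
count-∧ false f [] = ≡.refl
count-∧ false f (x ∷ xs) = count-∧ false f xs

count-cong : ∀ {A : Set} {f g : A → Bool} → (∀ x → f x ≡ g x) → ∀ xs → count f xs ≡ count g xs
count-cong f≗g [] = ≡.refl
count-cong f≗g (x ∷ xs) = ≡.cong₂ (λ b c → [ b ] + c) (f≗g x) (count-cong f≗g xs)

length-filter : ∀ {A : Set} {P : Pred A 0ℓ} (P? : Decidable P) xs →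
  length (filter P? xs) ≡ count (λ x → does (P? x)) xs
length-filter P? [] = ≡.refl
length-filter P? (x ∷ xs) with does (P? x)
... | true = ≡.cong suc (length-filter P? xs)
... | false = length-filter P? xs

sumTo : ℕ → (ℕ → ℕ) → ℕ
sumTo zero f = 0
sumTo (suc B) f = sumTo B f + f (suc B)

sumTo-cong : ∀ B {f g} → (∀ {x} → 1 ≤ x → x ≤ B → f x ≡ g x) → sumTo B f ≡ sumTo B g
sumTo-cong zero f≗g = ≡.refl
sumTo-cong (suc B) f≗g = ≡.cong₂ _+_ (sumTo-cong B (λ 1≤x x≤B → f≗g 1≤x (m≤n⇒m≤1+n x≤B))) (f≗g (s≤s z≤n) ≤-refl)

sumTo-zero : ∀ B {f} → (∀ {x} → 1 ≤ x → x ≤ B → f x ≡ 0) → sumTo B f ≡ 0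
sumTo-zero zero f≗0 = ≡.refl
sumTo-zero (suc B) f≗0 = ≡.cong₂ _+_ (sumTo-zero B (λ 1≤x x≤B → f≗0 1≤x (m≤n⇒m≤1+n x≤B))) (f≗0 (s≤s z≤n) ≤-refl)

sum-oneTo : ∀ m f → sum (map f (oneTo m)) ≡ sumTo m f
sum-oneTo zero f = ≡.refl
sum-oneTo (suc m) f = begin
  sum (map f (oneTo m ++ suc m ∷ []))        ≡⟨ ≡.cong sum (map-++ f (oneTo m) (suc m ∷ [])) ⟩
  sum (map f (oneTo m) ++ f (suc m) ∷ [])    ≡⟨ sum-++ (map f (oneTo m)) (f (suc m) ∷ []) ⟩
  sum (map f (oneTo m)) + (f (suc m) + 0)    ≡⟨ ≡.cong₂ _+_ (sum-oneTo m f) (+-identityʳ (f (suc m))) ⟩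
  sumTo m f + f (suc m)                      ∎
  where open ≡.≡-Reasoning

sumTo-truncate : ∀ m B f → B ≤ m → sumTo m (λ x → if does (x ≤? B) then f x else 0) ≡ sumTo B f
sumTo-truncate m B f B≤m with m≤n⇒m<n∨m≡n B≤m
sumTo-truncate (suc m) B f _ | inj₁ (s≤s B≤m) = ≡.trans
  (≡.cong (sumTo m _ +_) (≡.cong (if_then f (suc m) else 0) (dec-false (suc m ≤? B) (<⇒≱ (s≤s B≤m)))))
  (≡.trans (+-identityʳ _) (sumTo-truncate m B f B≤m))
sumTo-truncate m .m f _ | inj₂ ≡.refl =
  sumTo-cong m (λ {x} _ x≤m → ≡.cong (if_then f x else 0) (dec-true (x ≤? m) x≤m))

-- parts k B n counts the partitions of n into at most k allowed parts, the first
-- at most B and each part y after a part x satisfying y ≤ next x; next = id gives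
-- ordinary partitions, next = pred partitions into distinct parts.
module PartitionCount {Allowed : Pred ℕ 0ℓ} (Allowed? : Decidable Allowed)
                      (next : ℕ → ℕ) (next≤ : ∀ x → next x ≤ x) where

  parts : ℕ → ℕ → ℕ → ℕ
  term  : ℕ → ℕ → ℕ → ℕ

  parts zero B n = [ n ≡ᵇ 0 ]
  parts (suc k) B n = [ n ≡ᵇ 0 ] + sumTo B (term k n)

  term k n x = if does (Allowed? x ×-dec x ≤? n) then parts k (next x) (n ∸ x) else 0

  term-≰ : ∀ k {n x} → ¬ x ≤ n → term k n x ≡ 0
  term-≰ k {n} {x} x≰n with Allowed? x
  ... | yes _ rewrite dec-false (x ≤? n) x≰n = ≡.refl
  ... | no _ = ≡.refl

  term-forbidden : ∀ k {n x} → ¬ Allowed x → term k n x ≡ 0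
  term-forbidden k {x = x} ¬ax rewrite dec-false (Allowed? x) ¬ax = ≡.refl

  term-allowed : ∀ k {n x} → Allowed x → x ≤ n → term k n x ≡ parts k (next x) (n ∸ x)
  term-allowed k {n} {x} ax x≤n rewrite dec-true (Allowed? x) ax | dec-true (x ≤? n) x≤n = ≡.refl

  parts-step : ∀ k B n → n ≤ k → parts (suc k) B n ≡ parts k B n
  parts-step zero B zero _ = ≡.cong (1 +_) (sumTo-zero B (λ 1≤x _ → term-≰ zero (<⇒≱ 1≤x)))
  parts-step (suc k) B n n≤1+k = ≡.cong ([ n ≡ᵇ 0 ] +_) (sumTo-cong B term-step)
    where
    term-step : ∀ {x} → 1 ≤ x → x ≤ B → term (suc k) n x ≡ term k n x
    term-step {x} 1≤x _ = by-cases (Allowed? x) (x ≤? n)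
      where
      by-cases : Dec (Allowed x) → Dec (x ≤ n) → term (suc k) n x ≡ term k n x
      by-cases (yes ax) (yes x≤n) = ≡.trans (term-allowed (suc k) ax x≤n) (≡.trans
        (parts-step k (next x) (n ∸ x) (≤-trans (∸-monoʳ-≤ n 1≤x) (∸-monoˡ-≤ 1 n≤1+k)))
        (≡.sym (term-allowed k ax x≤n)))
      by-cases (no ¬ax) _ = ≡.trans (term-forbidden (suc k) ¬ax) (≡.sym (term-forbidden k ¬ax))
      by-cases _ (no x≰n) = ≡.trans (term-≰ (suc k) x≰n) (≡.sym (term-≰ k x≰n))

  parts-fuel : ∀ d B n → parts (d + n) B n ≡ parts n B n
  parts-fuel zero B n = ≡.refl
  parts-fuel (suc d) B n = ≡.trans (parts-step (d + n) B n (m≤n+m n d)) (parts-fuel d B n)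

  parts-enough : ∀ {k} B n → n ≤ k → parts k B n ≡ parts n B n
  parts-enough {k} B n n≤k = ≡.trans (≡.cong (λ j → parts j B n) (≡.sym (m∸n+n≡m n≤k))) (parts-fuel (k ∸ n) B n)

  partitionSeries : ℕ → Series
  coeff (partitionSeries B) n = parity (parts n B n)

  parity-parts-suc : ∀ k B n →
    parity (parts (suc k) (suc B) n) ≡ parity (parts (suc k) B n) ℙ.+ parity (term k n (suc B))
  parity-parts-suc k B n = ≡.trans (≡.cong parity (≡.sym (+-assoc [ n ≡ᵇ 0 ] (sumTo B (term k n)) _)))
    (ℙ.+-homo-+ ([ n ≡ᵇ 0 ] + sumTo B (term k n)) (term k n (suc B)))

  partitionSeries-allowed : ∀ B → Allowed (suc B) →
    partitionSeries (suc B) ≈ partitionSeries B ⊕ q^ suc B * partitionSeries (next (suc B))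
  partitionSeries-allowed B ax = coeffwise coefficient
    where
    top-term : ∀ k → parity (term k (suc k) (suc B)) ≡ coeff (q^ suc B * partitionSeries (next (suc B))) (suc k)
    top-term k with suc B ≤? suc k
    ... | yes (s≤s B≤k) = ≡.trans (≡.cong parity (≡.trans (term-allowed k ax (s≤s B≤k))
                            (parts-enough (next (suc B)) (k ∸ B) (m∸n≤m k B))))
                            (≡.sym (q^-≤ (partitionSeries (next (suc B))) (s≤s B≤k)))
    ... | no B≰k = ≡.trans (≡.cong parity (term-≰ k B≰k)) (≡.sym (q^-below _ (≰⇒> B≰k)))

    coefficient : ∀ n → coeff (partitionSeries (suc B)) n
                      ≡ coeff (partitionSeries B ⊕ q^ suc B * partitionSeries (next (suc B))) n
    coefficient zero = ≡.sym (ℙ.+-identityʳ 1ℙ)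
    coefficient (suc k) = ≡.trans (parity-parts-suc k B (suc k))
      (≡.cong (coeff (partitionSeries B) (suc k) ℙ.+_) (top-term k))

  partitionSeries-forbidden : ∀ B → ¬ Allowed (suc B) → partitionSeries (suc B) ≈ partitionSeries B
  partitionSeries-forbidden B ¬ax = coeffwise λ where
    zero → ≡.refl
    (suc k) → ≡.trans (parity-parts-suc k B (suc k))
      (≡.trans (≡.cong (λ t → coeff (partitionSeries B) (suc k) ℙ.+ parity t) (term-forbidden k {suc k} ¬ax))
        (ℙ.+-identityʳ (coeff (partitionSeries B) (suc k))))

  Admissible : ℕ → ℕ → List ℕ → Set
  Admissible B n [] = n ≡ 0
  Admissible B n (x ∷ L) = x ≤ B × 1 ≤ x × (Allowed x × x ≤ n) × Admissible (next x) (n ∸ x) L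

  admissible? : ∀ B n → Decidable (Admissible B n)
  admissible? B n [] = n ≟ 0
  admissible? B n (x ∷ L) =
    x ≤? B ×-dec 1 ≤? x ×-dec (Allowed? x ×-dec x ≤? n) ×-dec admissible? (next x) (n ∸ x) L

  count-admissible : ∀ k m B n → B ≤ m →
    count (λ L → does (admissible? B n L)) (listsUpTo k m) ≡ parts k B n
  count-admissible zero m B n _ = +-identityʳ [ n ≡ᵇ 0 ]
  count-admissible (suc k) m B n B≤m = ≡.cong ([ n ≡ᵇ 0 ] +_) (begin
    count adm (concatMap (λ x → map (x ∷_) (listsUpTo k m)) (oneTo m))
      ≡⟨ count-concatMap adm (λ x → map (x ∷_) (listsUpTo k m)) (oneTo m) ⟩
    sum (map (λ x → count adm (map (x ∷_) (listsUpTo k m))) (oneTo m))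
      ≡⟨ sum-oneTo m _ ⟩
    sumTo m (λ x → count adm (map (x ∷_) (listsUpTo k m)))
      ≡⟨ sumTo-cong m first-part ⟩
    sumTo m (λ x → if does (x ≤? B) then term k n x else 0)
      ≡⟨ sumTo-truncate m B (term k n) B≤m ⟩
    sumTo B (term k n)
      ∎)
    where
    open ≡.≡-Reasoning
    adm = λ L → does (admissible? B n L)
    first-part : ∀ {x} → 1 ≤ x → x ≤ m →
      count adm (map (x ∷_) (listsUpTo k m)) ≡ (if does (x ≤? B) then term k n x else 0)
    first-part {x} 1≤x x≤m
      rewrite count-map adm (x ∷_) (listsUpTo k m)
            | dec-true (1 ≤? x) 1≤x
            | count-∧ (does (x ≤? B))
                (λ L → does (Allowed? x ×-dec x ≤? n) ∧ does (admissible? (next x) (n ∸ x) L)) (listsUpTo k m)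
            | count-∧ (does (Allowed? x ×-dec x ≤? n))
                (λ L → does (admissible? (next x) (n ∸ x) L)) (listsUpTo k m)
            | count-admissible k m (next x) (n ∸ x) (≤-trans (next≤ x) x≤m) = ≡.refl

  Chain : List ℕ → Set
  Chain = Linked (λ x y → y ≤ next x)

  chain-cons : ∀ {x L} → All (_≤ next x) L → Chain L → Chain (x ∷ L)
  chain-cons [] [] = [-]
  chain-cons (y≤ ∷ _) ch = y≤ ∷ ch

  chain-bound : ∀ {x L} → Chain (x ∷ L) → All (_≤ next x) L
  chain-bound [-] = []
  chain-bound (y≤ ∷ ch) = Linked⇒All (λ y≤nx z≤ny → ≤-trans z≤ny (≤-trans (next≤ _) y≤nx)) y≤ ch

  admissible-sound : ∀ {B n} L → Admissible B n L →
    Chain L × All (_≤ B) L × All (0 <_) L × sum L ≡ n × All Allowed L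
  admissible-sound [] n≡0 = [] , [] , [] , ≡.sym n≡0 , []
  admissible-sound (x ∷ L) (x≤B , 1≤x , (ax , x≤n) , adm) with admissible-sound L adm
  ... | ch , bd , pos , sm , al =
    chain-cons bd ch , x≤B ∷ All.map (λ y≤ → ≤-trans y≤ (≤-trans (next≤ x) x≤B)) bd , 1≤x ∷ pos ,
    ≡.trans (≡.cong (x +_) sm) (m+[n∸m]≡n x≤n) , ax ∷ al

  admissible-complete : ∀ {B n} L → Chain L → All (_≤ B) L → All (0 <_) L → sum L ≡ n → All Allowed L →
    Admissible B n L
  admissible-complete [] _ _ _ sm _ = ≡.sym sm
  admissible-complete (x ∷ L) ch (x≤B ∷ _) (1≤x ∷ pos) sm (ax ∷ al) =
    x≤B , 1≤x , (ax , ≡.subst (x ≤_) sm (m≤m+n x (sum L))) ,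
    admissible-complete L (Linked.tail ch) (chain-bound ch) pos
      (≡.trans (≡.sym (m+n∸m≡n x (sum L))) (≡.cong (_∸ x) sm)) al

  countPartitions≡parts : ∀ {P : Pred (List ℕ) 0ℓ} (P? : Decidable P) →
    (∀ n L → (IsPartition n L × P L) ⇔ Admissible n n L) → ∀ n → countPartitions P P? n ≡ parts n n n
  countPartitions≡parts P? equivalence n = begin
    countPartitions _ P? n
      ≡⟨ length-filter (λ L → isPartition? n L ×-dec P? L) (listsUpTo n n) ⟩
    count (λ L → does (isPartition? n L ×-dec P? L)) (listsUpTo n n)
      ≡⟨ count-cong (λ L → does-⇔ (equivalence n L) (isPartition? n L ×-dec P? L) (admissible? n n L))
           (listsUpTo n n) ⟩
    count (λ L → does (admissible? n n L)) (listsUpTo n n)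
      ≡⟨ count-admissible n n n n ≤-refl ⟩
    parts n n n
      ∎
    where open ≡.≡-Reasoning

all-≤-sum : ∀ L → All (_≤ sum L) L
all-≤-sum [] = []
all-≤-sum (x ∷ L) = m≤m+n x (sum L) ∷ All.map (λ y≤ → ≤-trans y≤ (m≤n+m (sum L) x)) (all-≤-sum L)

parts-bounded : ∀ {n L} → IsPartition n L → All (_≤ n) L
parts-bounded {L = L} (_ , _ , sm) = ≡.subst (λ m → All (_≤ m) L) sm (all-≤-sum L)

module _ {Q : Pred ℕ 0ℓ} (Q? : Decidable Q) where
  open PartitionCount Q? (λ x → x) (λ _ → ≤-refl)

  partitionSeries≈divUpTo : ∀ B → partitionSeries B ≈ divUpTo (λ x → does (Q? x)) B 1ₛ
  partitionSeries≈divUpTo zero = coeffwise λ where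
    zero → ≡.refl
    (suc n) → ≡.refl
  partitionSeries≈divUpTo (suc B) with Q? (suc B)
  ... | yes qx = ≈-trans (/-unique (suc B) (partitionSeries-allowed B qx))
                   (cong (/-isMultiplier (suc B)) (partitionSeries≈divUpTo B))
  ... | no ¬qx = ≈-trans (partitionSeries-forbidden B ¬qx) (partitionSeries≈divUpTo B)

  parity-countPartitions-all : ∀ (P? : Decidable (All Q)) n →
    parity (countPartitions (All Q) P? n) ≡ coeff (divUpTo (λ x → does (Q? x)) n 1ₛ) n
  parity-countPartitions-all P? n = ≡.trans (≡.cong parity (countPartitions≡parts P? equivalence n))
    (at (partitionSeries≈divUpTo n) n)
    where
    equivalence : ∀ n L → (IsPartition n L × All Q L) ⇔ Admissible n n L
    equivalence n L = mk⇔
      (λ { (p@(ch , pos , sm) , al) → admissible-complete L ch (parts-bounded p) pos sm al })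
      (λ adm → let ch , _ , pos , sm , al = admissible-sound L adm in (ch , pos , sm) , al)

module _ {Q : Pred ℕ 0ℓ} (Q? : Decidable Q) where
  open PartitionCount Q? pred (λ _ → pred[n]≤n)

  partitionSeries≈mulUpTo : ∀ B → partitionSeries B ≈ mulUpTo (λ x → does (Q? x)) B 1ₛ
  partitionSeries≈mulUpTo zero = coeffwise λ where
    zero → ≡.refl
    (suc n) → ≡.refl
  partitionSeries≈mulUpTo (suc B) with Q? (suc B)
  ... | yes qx = ≈-trans (partitionSeries-allowed B qx)
                   (cong (*-isMultiplier (suc B)) (partitionSeries≈mulUpTo B))
  ... | no ¬qx = ≈-trans (partitionSeries-forbidden B ¬qx) (partitionSeries≈mulUpTo B)

  decreasing : ∀ {L} → Chain L → All (0 <_) L → Distinct L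
  decreasing [] _ = []
  decreasing [-] _ = [-]
  decreasing (y≤ ∷ ch) (_ ∷ pos@(0<y ∷ _)) = below-pred y≤ 0<y ∷ decreasing ch pos
    where
    below-pred : ∀ {x y} → y ≤ pred x → 0 < y → y < x
    below-pred {zero} z≤n ()
    below-pred {suc x} y≤x _ = s≤s y≤x

  parity-countPartitions-distinct : ∀ (P? : Decidable (λ L → Distinct L × All Q L)) n →
    parity (countPartitions (λ L → Distinct L × All Q L) P? n) ≡ coeff (mulUpTo (λ x → does (Q? x)) n 1ₛ) n
  parity-countPartitions-distinct P? n = ≡.trans (≡.cong parity (countPartitions≡parts P? equivalence n))
    (at (partitionSeries≈mulUpTo n) n)
    where
    equivalence : ∀ n L → (IsPartition n L × (Distinct L × All Q L)) ⇔ Admissible n n L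
    equivalence n L = mk⇔
      (λ { (p@(_ , pos , sm) , (dist , al)) →
             admissible-complete L (Linked.map <⇒≤pred dist) (parts-bounded p) pos sm al })
      (λ adm → let ch , _ , pos , sm , al = admissible-sound L adm
               in (Linked.map <⇒≤ (decreasing ch pos) , pos , sm) , (decreasing ch pos , al))

parity⇒%2 : ∀ m n → parity m ≡ parity n → m % 2 ≡ n % 2
parity⇒%2 zero zero _ = ≡.refl
parity⇒%2 (suc zero) (suc zero) _ = ≡.refl
parity⇒%2 zero (suc (suc n)) eq = parity⇒%2 zero n eq
parity⇒%2 (suc zero) (suc (suc n)) eq = parity⇒%2 (suc zero) n eq
parity⇒%2 (suc (suc m)) n eq = parity⇒%2 m n eq

countPartitions-all≡distinct-mod2 : ∀ {Q R : Pred ℕ 0ℓ} (Q? : Decidable Q) (R? : Decidable R) {p} →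
  Carry (λ x → does (Q? x)) (λ x → does (R? x)) p →
  ∀ (P? : Decidable (All Q)) (P′? : Decidable (λ L → Distinct L × All R L)) n →
  countPartitions (All Q) P? n % 2 ≡ countPartitions (λ L → Distinct L × All R L) P′? n % 2
countPartitions-all≡distinct-mod2 {Q} {R} Q? R? carry P? P′? n =
  parity⇒%2 (countPartitions (All Q) P? n) (countPartitions (λ L → Distinct L × All R L) P′? n) (begin
  parity (countPartitions (All Q) P? n)
    ≡⟨ parity-countPartitions-all Q? P? n ⟩
  coeff (divUpTo (λ x → does (Q? x)) n 1ₛ) n
    ≡⟨ divUpTo-coeff≡mulUpTo-coeff carry n ⟩
  coeff (mulUpTo (λ x → does (R? x)) n 1ₛ) n
    ≡⟨ ≡.sym (parity-countPartitions-distinct R? P′? n) ⟩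
  parity (countPartitions (λ L → Distinct L × All R L) P′? n)
    ∎)
  where open ≡.≡-Reasoning

isOdd : ℕ → Bool
isOdd x = does (x % 2 ≟ 1)

notDivisibleBy : ℕ → ℕ → Bool
notDivisibleBy ℓ x = does (¬? (ℓ ∣? x))

isOdd-double : ∀ m → isOdd (m + m) ≡ false
isOdd-double zero = ≡.refl
isOdd-double (suc m) rewrite +-suc m m = isOdd-double m

isOdd-double+1 : ∀ m → isOdd (suc (m + m)) ≡ true
isOdd-double+1 zero = ≡.refl
isOdd-double+1 (suc m) rewrite +-suc m m = isOdd-double+1 m

∨≡xor : ∀ {x y} → (y ≡ true → x ≡ false) → x ∨ y ≡ x xor y
∨≡xor {true} {true} disjoint with disjoint ≡.refl
... | ()
∨≡xor {true} {false} _ = ≡.refl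
∨≡xor {false} {true} _ = ≡.refl
∨≡xor {false} {false} _ = ≡.refl

even-carry : ∀ ℓ .{{_ : NonZero ℓ}} → 2 ∣ ℓ →
  Carry (notDivisibleBy ℓ) (λ x → does (dPart? ℓ x)) (λ x → not (isOdd x))
even-carry ℓ@(suc _) 2∣ℓ = record
  { carry-double = λ m → ≡.trans (≡.cong not (isOdd-double (suc m))) (≡.sym (double-allowed (suc m)))
  ; carry-odd = λ m → ≡.cong not (isOdd-double+1 m)
  ; residue = residue
  }
  where
  odd⇒notDivisible : ∀ {m} → isOdd m ≡ true → does (ℓ ∣? m) ≡ false
  odd⇒notDivisible {m} odd = dec-false (ℓ ∣? m) λ ℓ∣m →
    contradiction (≡.subst (λ r → does (r ≟ 1) ≡ true) (n∣m⇒m%n≡0 m 2 (∣-trans 2∣ℓ ℓ∣m)) odd) λ ()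

  double-allowed : ∀ m → notDivisibleBy ℓ m ∨ not (isOdd m) ≡ true
  double-allowed m with isOdd m in odd
  ... | true = ≡.trans (∨-identityʳ (notDivisibleBy ℓ m)) (≡.cong not (odd⇒notDivisible {m} odd))
  ... | false = ∨-zeroʳ _

  residue : ∀ m → does (dPart? ℓ (suc m)) ≡ notDivisibleBy ℓ (suc m) xor not (isOdd (suc m))
  residue m = begin
    does (M % ℓ ≟ 0) ∨ does (M % ℓ % 2 ≟ 1)
      ≡⟨ ≡.cong₂ _∨_ (does-⇔ (m%n≡0⇔n∣m M ℓ) (M % ℓ ≟ 0) (ℓ ∣? M))
                     (≡.cong (λ r → does (r ≟ 1)) (m∣n⇒o%n%m≡o%m 2 ℓ M 2∣ℓ)) ⟩
    does (ℓ ∣? M) ∨ isOdd M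
      ≡⟨ ∨≡xor (odd⇒notDivisible {M}) ⟩
    does (ℓ ∣? M) xor isOdd M
      ≡⟨ ≡.sym (xor-annihilates-not (does (ℓ ∣? M)) (isOdd M)) ⟩
    notDivisibleBy ℓ M xor not (isOdd M)
      ∎
    where
    open ≡.≡-Reasoning
    M = suc m

odd⇒coprime-2 : ∀ {ℓ} → ℓ % 2 ≡ 1 → Coprime ℓ 2
odd⇒coprime-2 {ℓ} ℓ-odd (i∣ℓ , i∣2) with irreducible[2] i∣2
... | inj₁ i≡1 = i≡1
... | inj₂ ≡.refl = contradiction (≡.trans (≡.sym ℓ-odd) (n∣m⇒m%n≡0 ℓ 2 i∣ℓ)) λ ()

odd-carry : ∀ ℓ → ℓ % 2 ≡ 1 →
  Carry (notDivisibleBy ℓ) (λ x → does ((x % 2 ≟ 1) ×-dec ¬? (ℓ ∣? x)))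
        (λ x → not (isOdd x) ∧ notDivisibleBy ℓ x)
odd-carry ℓ ℓ-odd = record
  { carry-double = λ m → carry-double (suc m)
  ; carry-odd = λ m → ≡.cong (λ b → not b ∧ notDivisibleBy ℓ (suc (m + m))) (isOdd-double+1 m)
  ; residue = λ m → residue (isOdd (suc m)) (notDivisibleBy ℓ (suc m))
  }
  where
  divides-double : ∀ m → does (ℓ ∣? (m + m)) ≡ does (ℓ ∣? m)
  divides-double m = does-⇔ (mk⇔ halve (λ ℓ∣m → ∣m∣n⇒∣m+n ℓ∣m ℓ∣m)) (ℓ ∣? (m + m)) (ℓ ∣? m)
    where
    halve : ℓ ∣ m + m → ℓ ∣ m
    halve ℓ∣2m =
      coprime-divisor (odd⇒coprime-2 ℓ-odd) (≡.subst (ℓ ∣_) (≡.cong (m +_) (≡.sym (+-identityʳ m))) ℓ∣2m)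

  carry-double : ∀ m →
    not (isOdd (m + m)) ∧ notDivisibleBy ℓ (m + m) ≡ notDivisibleBy ℓ m ∨ (not (isOdd m) ∧ notDivisibleBy ℓ m)
  carry-double m rewrite isOdd-double m | divides-double m | ∧-comm (not (isOdd m)) (notDivisibleBy ℓ m) =
    ≡.sym (∨-abs-∧ (notDivisibleBy ℓ m) (not (isOdd m)))

  residue : ∀ o d → o ∧ d ≡ d xor (not o ∧ d)
  residue true d = ≡.sym (xor-identityʳ d)
  residue false true = ≡.refl
  residue false false = ≡.refl

b≡d-mod2 : ∀ ℓ .{{_ : NonZero ℓ}} → 2 ∣ ℓ → ∀ n → b ℓ n % 2 ≡ d ℓ n % 2
b≡d-mod2 ℓ 2∣ℓ =
  countPartitions-all≡distinct-mod2 (λ p → ¬? (ℓ ∣? p)) (dPart? ℓ) (even-carry ℓ 2∣ℓ) (regular? ℓ) (dProp? ℓ)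

b≡c-mod2 : ∀ ℓ → ℓ % 2 ≡ 1 → ∀ n → b ℓ n % 2 ≡ c ℓ n % 2
b≡c-mod2 ℓ ℓ-odd = countPartitions-all≡distinct-mod2 (λ p → ¬? (ℓ ∣? p)) (λ p → (p % 2 ≟ 1) ×-dec ¬? (ℓ ∣? p))
  (odd-carry ℓ ℓ-odd) (regular? ℓ) (cProp? ℓ)

corollary1p3 : (ℓ n : ℕ) → 1 < ℓ → 0 < n →
    (ℓ % 2 ≡ 0 → b ℓ n % 2 ≡ d ℓ n % 2) × (ℓ % 2 ≡ 1 → b ℓ n % 2 ≡ c ℓ n % 2)
corollary1p3 zero n () _
corollary1p3 ℓ@(suc _) n _ _ =
  (λ ℓ-even → b≡d-mod2 ℓ (m%n≡0⇒n∣m ℓ 2 ℓ-even) n) , (λ ℓ-odd → b≡c-mod2 ℓ ℓ-odd n)
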